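{- Let $\tau$ be a middle shape such that every vertex of $\tau$ has a path to $U_\tau \cup V_\tau$. Then there is a set of edges $\mathrm{Res}(\tau)\subseteq E(\tau)$ with $|\mathrm{Res}(\tau)| \le |V(\tau)\setminus (U_\tau\cap V_\tau)|$ such that every vertex of $\tau$ has a path to $U_\tau \cup V_\tau$ using only edges of $\mathrm{Res}(\tau)$, and removing any subset of the edges in $E(\tau)\setminus \mathrm{Res}(\tau)$ does not change the size of the minimum vertex separator of the shape.
   Context: A shape $\tau$ consists of a finite multigraph $(V(\tau),E(\tau))$ without self-loops together with two subsets $U_\tau,V_\tau\subseteq V(\tau)$. A vertex separator of $\tau$ is a set $S\subseteq V(\tau)$ such that every path from a vertex of $U_\tau$ to a vertex of $V_\tau$ (including length-0 paths) contains a vertex of $S$. A minimum vertex separator (MVS) is a vertex separator of smallest possible size. An MVS $S$ is the leftmost MVS if for every MVS $S'$, every path from $U_\tau$ to a vertex of $S'$ contains a vertex of $S$; the rightmost MVS is defined symmetrically with $V_\tau$. $\tau$ is a middle shape if $U_\tau$ is its leftmost MVS and $V_\tau$ is its rightmost MVS. -}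

module Defs where

open import Data.Nat using (ℕ; _≤_)
open import Data.Fin using (Fin)
open import Data.Fin.Subset using (Subset; _∈_; _⊆_; ∣_∣; _∪_; _∩_; ∁; ⊤)
open import Data.Product using (Σ; _×_; _,_; ∃)
open import Data.Sum using (_⊎_)
open import Data.List using (List; []; _∷_)
open import Data.List.Relation.Unary.Any using (Any)
open import Data.List.Relation.Unary.Unique.Propositional using (Unique)
open import Relation.Binary.PropositionalEquality using (_≡_; _≢_)
open import Relation.Nullary using (¬_)

record Shape : Set where
  field
    n     : ℕ
    m     : ℕ
    ends  : Fin m → Fin n × Fin n
    noLoop : ∀ e → Σ.proj₁ (ends e) ≢ Σ.proj₂ (ends e)
    U     : Subset n
    V     : Subset n

module _ (τ : Shape) where
  open Shape τ

  EdgeSet : Set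
  EdgeSet = Subset m

  Adj : EdgeSet → Fin n → Fin n → Set
  Adj F u w = ∃ λ e → e ∈ F × ((ends e ≡ (u , w)) ⊎ (ends e ≡ (w , u)))

  data Walk (F : EdgeSet) : Fin n → Fin n → Set where
    here : ∀ v → Walk F v v
    step : ∀ {u w v} → Adj F u w → Walk F w v → Walk F u v

  verts : ∀ {F a b} → Walk F a b → List (Fin n)
  verts (here v) = v ∷ []
  verts (step {u} _ p) = u ∷ verts p

  Path : EdgeSet → Fin n → Fin n → Set
  Path F a b = Σ (Walk F a b) λ p → Unique (verts p)

  Meets : ∀ {F a b} → Path F a b → Subset n → Set
  Meets (p , _) S = Any (_∈ S) (verts p)

  IsSeparator : EdgeSet → Subset n → Set
  IsSeparator F S = ∀ a b → a ∈ U → b ∈ V → (p : Path F a b) → Meets p S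

  IsMVS : EdgeSet → Subset n → Set
  IsMVS F S = IsSeparator F S × (∀ S' → IsSeparator F S' → ∣ S ∣ ≤ ∣ S' ∣)

  IsLeftmostMVS : EdgeSet → Subset n → Set
  IsLeftmostMVS F S = IsMVS F S ×
    (∀ S' → IsMVS F S' → ∀ a b → a ∈ U → b ∈ S' → (p : Path F a b) → Meets p S)

  IsRightmostMVS : EdgeSet → Subset n → Set
  IsRightmostMVS F S = IsMVS F S ×
    (∀ S' → IsMVS F S' → ∀ a b → a ∈ S' → b ∈ V → (p : Path F a b) → Meets p S)

  AllEdges : EdgeSet
  AllEdges = ⊤

  IsMiddle : Set
  IsMiddle = IsLeftmostMVS AllEdges U × IsRightmostMVS AllEdges V

  Connected : EdgeSet → Set
  Connected F = ∀ v → ∃ λ b → b ∈ (U ∪ V) × Path F v b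

  nonShared : ℕ
  nonShared = ∣ ∁ (U ∩ V) ∣

{-# OPTIONS --safe #-}
-- U is a minimum vertex separator (only this part of the middle-shape hypothesis is needed), so
-- Menger's theorem, proved here by induction on the number of edges as in Diestel's first proof,
-- gives |U| vertex-disjoint U–V paths; cut each at its first vertex in V. Charge every vertex v at
-- most one edge: the edge by which its path leaves v if v lies on one of the paths, the first edge
-- of a shortest walk to U ∪ V if v lies neither on a path nor in U ∪ V, and nothing otherwise.
-- A vertex of U ∩ V can only be the last vertex of its path, so it is charged nothing, and the set
-- Res of charged edges has at most |V(τ) \ (U ∩ V)| elements. Following charged edges leads from
-- every vertex to U ∪ V, and the |U| disjoint paths inside Res keep every separator of any F ⊇ Res
-- at size at least |U|, while U itself still separates.
module Submission where

open import Defs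
open import Data.Empty using (⊥-elim) renaming (⊥ to Empty)
open import Data.Fin using (Fin; _≟_)
import Data.Fin as Fin
open import Data.Fin.Properties using (suc-injective; any?; 0≢1+n)
open import Data.Fin.Subset using (Subset; _∈_; _∉_; _⊆_; ∣_∣; _∪_; _∩_; ∁; ⊤; ⊥; ⁅_⁆; _-_; inside; outside)
open import Data.Fin.Subset.Properties
  using ( _∈?_; x∈p∪q⁻; x∈p∪q⁺; x∈p∩q⁻; x∈p∩q⁺; x∈⁅x⁆; x∈⁅y⁆⇒x≡y; x∈p∧x≢y⇒x∈p-y; x∉∁p⇒x∈p; ∈⊤; ∉⊥
        ; p─q⊆p; p─⊥≡p; ∪-identityˡ; ∪-identityʳ; ∪-comm; nonempty?; anySubset?; Empty-unique
        ; ∣⊥∣≡0; ∣⊤∣≡n; x∈p⇒∣p-x∣<∣p∣ )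
open import Data.List using (List; []; _∷_; length)
open import Data.List.Membership.Propositional using (find; lose) renaming (_∈_ to _∈ₗ_)
open import Data.List.Relation.Unary.All as All using (All; []; _∷_)
open import Data.List.Relation.Unary.All.Properties using (¬Any⇒All¬)
open import Data.List.Relation.Unary.AllPairs using ([]; _∷_)
open import Data.List.Relation.Unary.Any as Any using (here; there)
open import Data.List.Relation.Unary.Unique.Propositional using (Unique)
open import Data.Maybe using (Maybe; just; nothing; maybe′)
open import Data.Nat using (ℕ; zero; suc; _≤_; _<_; z≤n; s≤s; _<?_)
open import Data.Nat.Properties using (≤-refl; ≤-trans; ≤-antisym; ≤-pred; ≮⇒≥; <⇒≱; <-≤-trans; <-irrefl; n≤1+n)
open import Data.Product using (Σ; _×_; _,_; ∃; ∃₂; proj₁; proj₂)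
open import Data.Product.Properties using (≡-dec)
open import Data.Sum using (_⊎_; inj₁; inj₂; map₂)
open import Data.Unit using (tt) renaming (⊤ to Unit)
import Data.Vec.Base as Vec
open import Data.Vec.Base using ([]; _∷_)
open import Function.Definitions using (Injective)
open import Relation.Binary.Definitions using (DecidableEquality)
open import Relation.Binary.PropositionalEquality
  using (_≡_; _≢_; refl; sym; trans; cong; cong₂; subst; module ≡-Reasoning)
open import Relation.Nullary using (¬_; Dec; yes; no; ¬?)
open import Relation.Nullary.Decidable using (_×-dec_; _⊎-dec_)
open import Relation.Unary using (Decidable)

private variable
  N M k : ℕ

∣p∣≡1+∣p-x∣ : {x : Fin N} {p : Subset N} → x ∈ p → ∣ p ∣ ≡ suc ∣ p - x ∣
∣p∣≡1+∣p-x∣ {x = Fin.zero}  {inside ∷ p}  Vec.here         = cong (λ q → suc ∣ q ∣) (sym (p─⊥≡p p))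
∣p∣≡1+∣p-x∣ {x = Fin.suc _} {inside ∷ _}  (Vec.there x∈p) = cong suc (∣p∣≡1+∣p-x∣ x∈p)
∣p∣≡1+∣p-x∣ {x = Fin.suc _} {outside ∷ _} (Vec.there x∈p) = ∣p∣≡1+∣p-x∣ x∈p

x∈p-y⇒x≢y : {x y : Fin N} {p : Subset N} → x ∈ p - y → x ≢ y
x∈p-y⇒x≢y {x = Fin.zero}  {Fin.zero}  {inside ∷ _} () refl
x∈p-y⇒x≢y {x = Fin.suc _} {Fin.suc _} {_ ∷ _} (Vec.there x∈) refl = x∈p-y⇒x≢y x∈ refl

injective⇒≤∣p∣ : (p : Subset N) (f : Fin k → Fin N) → (∀ i → f i ∈ p) →
                 Injective _≡_ _≡_ f → k ≤ ∣ p ∣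
injective⇒≤∣p∣ {k = zero}  p f f∈p f-inj = z≤n
injective⇒≤∣p∣ {k = suc k} p f f∈p f-inj =
  subst (suc k ≤_) (sym (∣p∣≡1+∣p-x∣ (f∈p Fin.zero)))
    (s≤s (injective⇒≤∣p∣ (p - f Fin.zero) (λ i → f (Fin.suc i))
      (λ i → x∈p∧x≢y⇒x∈p-y (f∈p (Fin.suc i)) (λ eq → 0≢1+n (sym (f-inj eq))))
      (λ eq → suc-injective (f-inj eq))))

0<∣p∣⇒nonempty : (p : Subset N) → 0 < ∣ p ∣ → ∃ λ x → x ∈ p
0<∣p∣⇒nonempty {N} p 0<∣p∣ with nonempty? p
... | yes p≢∅ = p≢∅
... | no  p≡∅ = ⊥-elim (<-irrefl (sym (trans (cong ∣_∣ (Empty-unique p≡∅)) (∣⊥∣≡0 N))) 0<∣p∣)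

≤∣p∣⇒injective : (p : Subset N) → k ≤ ∣ p ∣ →
                 Σ (Fin k → Fin N) λ f → (∀ i → f i ∈ p) × Injective _≡_ _≡_ f
≤∣p∣⇒injective {k = zero}  p _ = (λ ()) , (λ ()) , λ { {()} }
≤∣p∣⇒injective {k = suc k} p k<∣p∣
  with x , x∈p ← 0<∣p∣⇒nonempty p (≤-trans (s≤s z≤n) k<∣p∣)
  with g , g∈ , g-inj ← ≤∣p∣⇒injective (p - x) (≤-pred (subst (suc k ≤_) (∣p∣≡1+∣p-x∣ x∈p) k<∣p∣))
  = f , f∈p , f-inj
  where
  f : Fin (suc k) → Fin _
  f Fin.zero    = x
  f (Fin.suc i) = g i
  f∈p : ∀ i → f i ∈ p
  f∈p Fin.zero    = x∈p
  f∈p (Fin.suc i) = p─q⊆p p _ (g∈ i)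
  f-inj : Injective _≡_ _≡_ f
  f-inj {Fin.zero}  {Fin.zero}  _  = refl
  f-inj {Fin.zero}  {Fin.suc j} eq = ⊥-elim (x∈p-y⇒x≢y (g∈ j) (sym eq))
  f-inj {Fin.suc i} {Fin.zero}  eq = ⊥-elim (x∈p-y⇒x≢y (g∈ i) eq)
  f-inj {Fin.suc i} {Fin.suc j} eq = cong Fin.suc (g-inj eq)

injective⇒surjective : (p : Subset N) (f : Fin k → Fin N) → (∀ i → f i ∈ p) →
                       Injective _≡_ _≡_ f → ∣ p ∣ ≤ k → ∀ {y} → y ∈ p → ∃ λ i → f i ≡ y
injective⇒surjective p f f∈p f-inj ∣p∣≤k {y} y∈p with any? (λ i → f i ≟ y)
... | yes hit = hit
... | no miss = ⊥-elim (<-irrefl refl (≤-trans (s≤s k≤∣p-y∣) (subst (_≤ _) (∣p∣≡1+∣p-x∣ y∈p) ∣p∣≤k)))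
  where
  k≤∣p-y∣ : _ ≤ ∣ p - y ∣
  k≤∣p-y∣ = injective⇒≤∣p∣ (p - y) f (λ i → x∈p∧x≢y⇒x∈p-y (f∈p i) (λ eq → miss (i , eq))) f-inj

unique⇒length≤∣p∣ : (p : Subset N) {xs : List (Fin N)} → Unique xs → All (_∈ p) xs → length xs ≤ ∣ p ∣
unique⇒length≤∣p∣ p {[]}     _              _           = z≤n
unique⇒length≤∣p∣ p {x ∷ xs} (x∉xs ∷ xs-uniq) (x∈p ∷ xs⊆p) =
  subst (suc (length xs) ≤_) (sym (∣p∣≡1+∣p-x∣ x∈p))
    (s≤s (unique⇒length≤∣p∣ (p - x) xs-uniq
      (All.zipWith (λ (x≢y , y∈p) → x∈p∧x≢y⇒x∈p-y y∈p (λ eq → x≢y (sym eq))) (x∉xs , xs⊆p))))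

unique⇒length≤N : {xs : List (Fin N)} → Unique xs → length xs ≤ N
unique⇒length≤N {N} {xs} uniq =
  subst (length xs ≤_) (∣⊤∣≡n N) (unique⇒length≤∣p∣ ⊤ uniq (All.universal (λ _ → ∈⊤) xs))

∣p∪⁅x⁆∣≤1+∣p∣ : (p : Subset N) (x : Fin N) → ∣ p ∪ ⁅ x ⁆ ∣ ≤ suc ∣ p ∣
∣p∪⁅x⁆∣≤1+∣p∣ (inside ∷ p)  Fin.zero    = s≤s (subst (_≤ suc ∣ p ∣) (cong ∣_∣ (sym (∪-identityʳ p))) (n≤1+n _))
∣p∪⁅x⁆∣≤1+∣p∣ (outside ∷ p) Fin.zero    = s≤s (subst (_≤ ∣ p ∣) (cong ∣_∣ (sym (∪-identityʳ p))) ≤-refl)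
∣p∪⁅x⁆∣≤1+∣p∣ (inside ∷ p)  (Fin.suc x) = s≤s (∣p∪⁅x⁆∣≤1+∣p∣ p x)
∣p∪⁅x⁆∣≤1+∣p∣ (outside ∷ p) (Fin.suc x) = ∣p∪⁅x⁆∣≤1+∣p∣ p x

image : (Fin N → Maybe (Fin M)) → Subset M
image {zero}  g = ⊥
image {suc N} g = maybe′ ⁅_⁆ ⊥ (g Fin.zero) ∪ image (λ v → g (Fin.suc v))

∈-image : (g : Fin N → Maybe (Fin M)) (v : Fin N) {e : Fin M} → g v ≡ just e → e ∈ image g
∈-image g Fin.zero    eq rewrite eq = x∈p∪q⁺ (inj₁ (x∈⁅x⁆ _))
∈-image g (Fin.suc v) eq = x∈p∪q⁺ (inj₂ (∈-image (λ v → g (Fin.suc v)) v eq))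

∣image∣≤∣p∣ : (g : Fin N → Maybe (Fin M)) (p : Subset N) → (∀ v → v ∉ p → g v ≡ nothing) →
              ∣ image g ∣ ≤ ∣ p ∣
∣image∣≤∣p∣ {zero} {M} g [] _ = subst (_≤ 0) (sym (∣⊥∣≡0 M)) z≤n
∣image∣≤∣p∣ {suc N} g (inside ∷ p) outside-p≡nothing =
  ≤-trans (∣[x]∪q∣≤1+∣q∣ (g Fin.zero)) (s≤s (∣image∣≤∣p∣ (λ v → g (Fin.suc v)) p
    (λ v v∉p → outside-p≡nothing (Fin.suc v) λ { (Vec.there v∈p) → v∉p v∈p })))
  where
  ∣[x]∪q∣≤1+∣q∣ : ∀ {q} (x : Maybe (Fin _)) → ∣ maybe′ ⁅_⁆ ⊥ x ∪ q ∣ ≤ suc ∣ q ∣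
  ∣[x]∪q∣≤1+∣q∣ {q} nothing  = subst (_≤ suc ∣ q ∣) (cong ∣_∣ (sym (∪-identityˡ q))) (n≤1+n _)
  ∣[x]∪q∣≤1+∣q∣ {q} (just e) = subst (_≤ suc ∣ q ∣) (cong ∣_∣ (∪-comm q ⁅ e ⁆)) (∣p∪⁅x⁆∣≤1+∣p∣ q e)
∣image∣≤∣p∣ {suc N} g (outside ∷ p) outside-p≡nothing
  rewrite outside-p≡nothing Fin.zero (λ ()) =
  subst (_≤ ∣ p ∣) (cong ∣_∣ (sym (∪-identityˡ (image (λ v → g (Fin.suc v))))))
    (∣image∣≤∣p∣ (λ v → g (Fin.suc v)) p
      (λ v v∉p → outside-p≡nothing (Fin.suc v) λ { (Vec.there v∈p) → v∉p v∈p }))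

least-witness : {P : ℕ → Set} → Decidable P → ∀ {l} → P l → ∃ λ d → P d × (∀ {j} → j < d → ¬ P j)
least-witness P? {zero}  p = zero , p , λ ()
least-witness P? {suc l} p with P? zero
... | yes p₀ = zero , p₀ , λ ()
... | no ¬p₀ with d , pd , below ← least-witness (λ j → P? (suc j)) {l} p =
  suc d , pd , λ { {zero} _ → ¬p₀ ; {suc j} (s≤s j<d) → below j<d }

module Walks (τ : Shape) where
  open Shape τ

  private variable
    F F′ : EdgeSet τ
    a b c d u v w : Fin n
    l : ℕ
    A B S Z : Subset n

  infix 4 _∈ʷ_ _⊆ʷ_
  _∈ʷ_ : Fin n → Walk τ F a b → Set
  v ∈ʷ p = v ∈ₗ verts τ p

  _⊆ʷ_ : Walk τ F a b → Walk τ F′ c d → Set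
  p ⊆ʷ q = ∀ {v} → v ∈ʷ p → v ∈ʷ q

  Avoids : Subset n → Walk τ F a b → Set
  Avoids S p = ∀ {v} → v ∈ʷ p → v ∉ S

  source∈ʷ : (p : Walk τ F a b) → a ∈ʷ p
  source∈ʷ (here _)   = here refl
  source∈ʷ (step _ _) = here refl

  target∈ʷ : (p : Walk τ F a b) → b ∈ʷ p
  target∈ʷ (here _)   = here refl
  target∈ʷ (step _ p) = there (target∈ʷ p)

  infixr 5 _++ʷ_ _++ʷ⟨_⟩_
  _++ʷ_ : Walk τ F a b → Walk τ F b c → Walk τ F a c
  here _   ++ʷ q = q
  step x p ++ʷ q = step x (p ++ʷ q)

  ∈-++ʷ⁻ : (p : Walk τ F a b) {q : Walk τ F b c} → v ∈ʷ p ++ʷ q → v ∈ʷ p ⊎ v ∈ʷ q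
  ∈-++ʷ⁻ (here _)   v∈q         = inj₂ v∈q
  ∈-++ʷ⁻ (step _ _) (here refl) = inj₁ (here refl)
  ∈-++ʷ⁻ (step _ p) (there v∈)  with ∈-++ʷ⁻ p v∈
  ... | inj₁ v∈p = inj₁ (there v∈p)
  ... | inj₂ v∈q = inj₂ v∈q

  _++ʷ⟨_⟩_ : Walk τ F a b → b ≡ c → Walk τ F c d → Walk τ F a d
  p ++ʷ⟨ refl ⟩ q = p ++ʷ q

  avoids-++ʷ : (p : Walk τ F a b) {q : Walk τ F b c} → Avoids S p → Avoids S q → Avoids S (p ++ʷ q)
  avoids-++ʷ p p-avoids q-avoids v∈ with ∈-++ʷ⁻ p v∈
  ... | inj₁ v∈p = p-avoids v∈p
  ... | inj₂ v∈q = q-avoids v∈q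

  Adj-sym : Adj τ F u w → Adj τ F w u
  Adj-sym (e , e∈F , inj₁ eq) = e , e∈F , inj₂ eq
  Adj-sym (e , e∈F , inj₂ eq) = e , e∈F , inj₁ eq

  reverseʷ : Walk τ F a b → Walk τ F b a
  reverseʷ (here v)   = here v
  reverseʷ (step x p) = reverseʷ p ++ʷ step (Adj-sym x) (here _)

  ∈-reverseʷ⁻ : (p : Walk τ F a b) → v ∈ʷ reverseʷ p → v ∈ʷ p
  ∈-reverseʷ⁻ (here _)   v∈ = v∈
  ∈-reverseʷ⁻ (step x p) v∈ with ∈-++ʷ⁻ (reverseʷ p) v∈
  ... | inj₁ v∈p                = there (∈-reverseʷ⁻ p v∈p)
  ... | inj₂ (here refl)        = there (source∈ʷ p)
  ... | inj₂ (there (here refl)) = here refl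

  avoids-reverseʷ : (p : Walk τ F a b) → Avoids S p → Avoids S (reverseʷ p)
  avoids-reverseʷ p p-avoids v∈ = p-avoids (∈-reverseʷ⁻ p v∈)

  weaken : F ⊆ F′ → Walk τ F a b → Walk τ F′ a b
  weaken F⊆F′ (here v)                 = here v
  weaken F⊆F′ (step (e , e∈F , eq) p) = step (e , F⊆F′ e∈F , eq) (weaken F⊆F′ p)

  verts-weaken : (F⊆F′ : F ⊆ F′) (p : Walk τ F a b) → verts τ (weaken F⊆F′ p) ≡ verts τ p
  verts-weaken F⊆F′ (here _)       = refl
  verts-weaken F⊆F′ (step {u} _ p) = cong (u ∷_) (verts-weaken F⊆F′ p)

  ∈-weaken⁻ : (F⊆F′ : F ⊆ F′) (p : Walk τ F a b) → v ∈ʷ weaken F⊆F′ p → v ∈ʷ p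
  ∈-weaken⁻ F⊆F′ p = subst (_ ∈ₗ_) (verts-weaken F⊆F′ p)

  suffixFrom : (p : Walk τ F a b) → v ∈ʷ p →
               Σ (Walk τ F v b) λ q → q ⊆ʷ p × (Unique (verts τ p) → Unique (verts τ q))
  suffixFrom (here _)     (here refl) = here _ , (λ v∈ → v∈) , (λ uniq → uniq)
  suffixFrom (step x p)   (here refl) = step x p , (λ v∈ → v∈) , (λ uniq → uniq)
  suffixFrom (step _ p)   (there v∈p) with q , q⊆p , q-uniq ← suffixFrom p v∈p =
    q , (λ v∈q → there (q⊆p v∈q)) , λ { (_ ∷ p-uniq) → q-uniq p-uniq }

  loopErase : (p : Walk τ F a b) → Σ (Walk τ F a b) λ q → Unique (verts τ q) × q ⊆ʷ p
  loopErase (here v) = here v , ([] ∷ []) , (λ v∈ → v∈)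
  loopErase (step {u} x p) with q , q-uniq , q⊆p ← loopErase p with Any.any? (u ≟_) (verts τ q)
  ... | yes u∈q with r , r⊆q , r-uniq ← suffixFrom q u∈q =
    r , r-uniq q-uniq , λ v∈r → there (q⊆p (r⊆q v∈r))
  ... | no u∉q =
    step x q , (¬Any⇒All¬ _ u∉q ∷ q-uniq) , λ { (here eq) → here eq ; (there v∈q) → there (q⊆p v∈q) }

  toPath : Walk τ F a b → Path τ F a b
  toPath p = let q , q-uniq , _ = loopErase p in q , q-uniq

  AvoidsInit : Subset n → Walk τ F a b → Set
  AvoidsInit Z (here _)       = Unit
  AvoidsInit Z (step {u} _ p) = u ∉ Z × AvoidsInit Z p

  avoids⇒avoidsInit : (p : Walk τ F a b) → Avoids Z p → AvoidsInit Z p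
  avoids⇒avoidsInit (here _)   _        = tt
  avoids⇒avoidsInit (step _ p) p-avoids = p-avoids (here refl) , avoids⇒avoidsInit p (λ v∈ → p-avoids (there v∈))

  avoidsInit-target : (p : Walk τ F a b) → AvoidsInit Z p → v ∈ʷ p → v ∈ Z → v ≡ b
  avoidsInit-target (here _)   _               (here refl) _   = refl
  avoidsInit-target (step _ p) (u∉Z , _)       (here refl) u∈Z = ⊥-elim (u∉Z u∈Z)
  avoidsInit-target (step _ p) (_ , p-avoids)  (there v∈p) v∈Z = avoidsInit-target p p-avoids v∈p v∈Z

  avoidsInit⇒avoids : (p : Walk τ F a b) → AvoidsInit Z p → S ⊆ Z → b ∉ S → Avoids S p
  avoidsInit⇒avoids p p-avoids S⊆Z b∉S v∈p v∈S =
    b∉S (subst (_∈ _) (avoidsInit-target p p-avoids v∈p (S⊆Z v∈S)) v∈S)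

  prefixAvoiding : (p : Walk τ F a b) → AvoidsInit Z p → S ⊆ Z → v ∈ʷ p → v ∉ S → Σ (Walk τ F a v) (Avoids S)
  prefixAvoiding (here _)   _ _ (here refl) v∉S = here _ , λ { (here refl) → v∉S }
  prefixAvoiding (step _ _) _ _ (here refl) v∉S = here _ , λ { (here refl) → v∉S }
  prefixAvoiding (step x p) (u∉Z , p-avoids) S⊆Z (there v∈p) v∉S
    with q , q-avoids ← prefixAvoiding p p-avoids S⊆Z v∈p v∉S =
    step x q , λ { (here refl) u∈S → u∉Z (S⊆Z u∈S) ; (there v∈q) → q-avoids v∈q }

  record FirstHit (Z : Subset n) (p : Walk τ F a b) : Set where
    constructor firstHit
    field
      {hit}      : Fin n
      hit∈       : hit ∈ Z
      prefix     : Walk τ F a hit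
      avoidsInit : AvoidsInit Z prefix
      prefix⊆    : prefix ⊆ʷ p

  firstHit? : (Z : Subset n) (p : Walk τ F a b) → Avoids Z p ⊎ FirstHit Z p
  firstHit? Z (here v) with v ∈? Z
  ... | yes v∈Z = inj₂ (firstHit v∈Z (here v) tt (λ v∈ → v∈))
  ... | no  v∉Z = inj₁ λ { (here refl) → v∉Z }
  firstHit? Z (step {u} x p) with u ∈? Z
  ... | yes u∈Z = inj₂ (firstHit u∈Z (here u) tt λ { (here eq) → here eq })
  ... | no  u∉Z with firstHit? Z p
  ...   | inj₁ p-avoids = inj₁ λ { (here refl) → u∉Z ; (there v∈p) → p-avoids v∈p }
  ...   | inj₂ (firstHit h∈Z q q-avoids q⊆p) =
    inj₂ (firstHit h∈Z (step x q) (u∉Z , q-avoids) λ { (here eq) → here eq ; (there v∈q) → there (q⊆p v∈q) })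

  firstHitOfTarget : (p : Walk τ F a b) → b ∈ Z → FirstHit Z p
  firstHitOfTarget {Z = Z} p b∈Z with firstHit? Z p
  ... | inj₁ p-avoids = ⊥-elim (p-avoids (target∈ʷ p) b∈Z)
  ... | inj₂ hit      = hit

  Joins : Fin m → Fin n → Fin n → Set
  Joins e x y = ends e ≡ (x , y) ⊎ ends e ≡ (y , x)

  EndsIn : Fin m → Subset n → Set
  EndsIn e Z = proj₁ (ends e) ∈ Z × proj₂ (ends e) ∈ Z

  joins⇒endsIn : ∀ {e x y} → Joins e x y → x ∈ Z → y ∈ Z → EndsIn e Z
  joins⇒endsIn (inj₁ refl) x∈Z y∈Z = x∈Z , y∈Z
  joins⇒endsIn (inj₂ refl) x∈Z y∈Z = y∈Z , x∈Z

  endsIn-joins : ∀ {e x y} → EndsIn e Z → Joins e x y → x ∈ Z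
  endsIn-joins (x∈Z , _) (inj₁ refl) = x∈Z
  endsIn-joins (_ , x∈Z) (inj₂ refl) = x∈Z

  withoutEdge : ∀ {e} (p : Walk τ F a b) → AvoidsInit Z p → EndsIn e Z →
                Σ (Walk τ (F - e) a b) λ q → verts τ q ≡ verts τ p
  withoutEdge (here v) _ _ = here v , refl
  withoutEdge {Z = Z} {e = e} (step {u} (e′ , e′∈F , joins) p) (u∉Z , p-avoids) e-in-Z
    with q , q≡p ← withoutEdge p p-avoids e-in-Z =
    step (e′ , x∈p∧x≢y⇒x∈p-y e′∈F e′≢e , joins) q , cong (u ∷_) q≡p
    where
    e′≢e : e′ ≢ e
    e′≢e refl = u∉Z (endsIn-joins e-in-Z joins)

  avoids-≡ : {p : Walk τ F a b} {q : Walk τ F′ c d} → verts τ q ≡ verts τ p → Avoids S p → Avoids S q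
  avoids-≡ q≡p p-avoids v∈q = p-avoids (subst (_ ∈ₗ_) q≡p v∈q)

  record Reaching (F : EdgeSet τ) (S A : Subset n) (b : Fin n) : Set where
    constructor reaching
    field
      {source} : Fin n
      source∈  : source ∈ A
      walk     : Walk τ F source b
      avoids   : Avoids S walk

  Separates : EdgeSet τ → (A B S : Subset n) → Set
  Separates F A B S = ∀ {b} → b ∈ B → ¬ Reaching F S A b

  meeting⇒¬separates : Reaching F S A v → Reaching F S B v → ¬ Separates F A B S
  meeting⇒¬separates (reaching a∈A p p-avoids) (reaching b∈B q q-avoids) sep =
    sep b∈B (reaching a∈A (p ++ʷ reverseʷ q) (avoids-++ʷ p p-avoids (avoids-reverseʷ q q-avoids)))

  separates-sym : Separates F A B S → Separates F B A S
  separates-sym sep a∈A (reaching b∈B p p-avoids) = sep b∈B (reaching a∈A (reverseʷ p) (avoids-reverseʷ p p-avoids))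

  separates⇒isSeparator : Separates F U V S → IsSeparator τ F S
  separates⇒isSeparator {S = S} sep a b a∈U b∈V (p , _) with Any.any? (_∈? S) (verts τ p)
  ... | yes meets = meets
  ... | no misses = ⊥-elim (sep b∈V (reaching a∈U p λ v∈p v∈S → misses (lose v∈p v∈S)))

  isSeparator⇒separates : IsSeparator τ F S → Separates F U V S
  isSeparator⇒separates sep b∈V (reaching a∈U p p-avoids)
    with q , q-uniq , q⊆p ← loopErase p
    with v , v∈q , v∈S ← find (sep _ _ a∈U b∈V (q , q-uniq)) = p-avoids (q⊆p v∈q) v∈S

  walkLength : Walk τ F a b → ℕ
  walkLength (here _)   = zero
  walkLength (step _ p) = suc (walkLength p)

  unique⇒walkLength<n : (p : Walk τ F a b) → Unique (verts τ p) → walkLength p < n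
  unique⇒walkLength<n p uniq = subst (_≤ n) (length-verts p) (unique⇒length≤N uniq)
    where
    length-verts : (p : Walk τ F a b) → length (verts τ p) ≡ suc (walkLength p)
    length-verts (here _)   = refl
    length-verts (step _ p) = cong suc (length-verts p)

  ReachesWithin : EdgeSet τ → (S B : Subset n) → ℕ → Fin n → Set
  ReachesWithin F S B zero    a = a ∉ S × a ∈ B
  ReachesWithin F S B (suc l) a =
    ReachesWithin F S B zero a ⊎ (a ∉ S × ∃ λ w → Adj τ F a w × ReachesWithin F S B l w)

  adj? : ∀ F u w → Dec (Adj τ F u w)
  adj? F u w = any? λ e → (e ∈? F) ×-dec ((ends e ≟² (u , w)) ⊎-dec (ends e ≟² (w , u)))
    where
    _≟²_ : DecidableEquality (Fin n × Fin n)
    _≟²_ = ≡-dec _≟_ _≟_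

  reachesWithin? : ∀ F S B l a → Dec (ReachesWithin F S B l a)
  reachesWithin? F S B zero    a = ¬? (a ∈? S) ×-dec (a ∈? B)
  reachesWithin? F S B (suc l) a =
    reachesWithin? F S B zero a ⊎-dec (¬? (a ∈? S) ×-dec any? λ w → adj? F a w ×-dec reachesWithin? F S B l w)

  reachesWithin⇒walk : ReachesWithin F S B l a → ∃ λ b → b ∈ B × Σ (Walk τ F a b) (Avoids S)
  reachesWithin⇒walk {l = zero}  (a∉S , a∈B) = _ , a∈B , here _ , λ { (here refl) → a∉S }
  reachesWithin⇒walk {l = suc l} (inj₁ r) = reachesWithin⇒walk {l = zero} r
  reachesWithin⇒walk {l = suc l} (inj₂ (a∉S , _ , adj , r))
    with b , b∈B , p , p-avoids ← reachesWithin⇒walk r =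
    b , b∈B , step adj p , λ { (here refl) → a∉S ; (there v∈p) → p-avoids v∈p }

  walk⇒reachesWithin : (p : Walk τ F a b) → b ∈ B → Avoids S p → walkLength p ≤ l → ReachesWithin F S B l a
  walk⇒reachesWithin {l = zero}  (here _)     b∈B p-avoids _ = p-avoids (here refl) , b∈B
  walk⇒reachesWithin {l = suc l} (here _)     b∈B p-avoids _ = inj₁ (p-avoids (here refl) , b∈B)
  walk⇒reachesWithin {l = suc l} (step adj p) b∈B p-avoids (s≤s len≤l) =
    inj₂ (p-avoids (here refl) , _ , adj , walk⇒reachesWithin p b∈B (λ v∈p → p-avoids (there v∈p)) len≤l)

  -- Length n suffices because a loop-erased witness is a path.
  reaches? : ∀ F S A B → Dec (∃ λ b → b ∈ B × Reaching F S A b)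
  reaches? F S A B with any? (λ a → (a ∈? A) ×-dec reachesWithin? F S B n a)
  ... | yes (_ , a∈A , r) with b , b∈B , p , p-avoids ← reachesWithin⇒walk r =
    yes (b , b∈B , reaching a∈A p p-avoids)
  ... | no unreachable = no λ (b , b∈B , reaching a∈A p p-avoids) →
    let q , q-uniq , q⊆p = loopErase p in
    unreachable (_ , a∈A , walk⇒reachesWithin q b∈B (λ v∈q → p-avoids (q⊆p v∈q))
                                                 (≤-trans (n≤1+n _) (unique⇒walkLength<n q q-uniq)))

  separates? : ∀ F A B S → Dec (Separates F A B S)
  separates? F A B S with reaches? F S A B
  ... | yes (_ , b∈B , r) = no λ sep → sep b∈B r
  ... | no unreachable   = yes λ b∈B r → unreachable (_ , b∈B , r)

  exitEdge : Walk τ F a b → Fin n → Maybe (Fin m)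
  exitEdge (here _)             v = nothing
  exitEdge (step {u} (e , _) p) v with u ≟ v
  ... | yes _ = just e
  ... | no  _ = exitEdge p v

  exitEdge-source : (x : Adj τ F u w) (p : Walk τ F w b) → exitEdge (step x p) u ≡ just (proj₁ x)
  exitEdge-source {u = u} _ _ with u ≟ u
  ... | yes _  = refl
  ... | no u≢u = ⊥-elim (u≢u refl)

  exitEdge-later : (x : Adj τ F u w) (p : Walk τ F w b) → u ≢ v → exitEdge (step x p) v ≡ exitEdge p v
  exitEdge-later {u = u} {v = v} _ _ u≢v with u ≟ v
  ... | yes u≡v = ⊥-elim (u≢v u≡v)
  ... | no  _   = refl

  exitEdge-target : (p : Walk τ F a b) → Unique (verts τ p) → exitEdge p b ≡ nothing
  exitEdge-target (here _) _ = refl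
  exitEdge-target {b = b} (step {u} _ p) (u∉p ∷ p-uniq) with u ≟ b
  ... | yes u≡b = ⊥-elim (All.lookup u∉p (target∈ʷ p) u≡b)
  ... | no  _   = exitEdge-target p p-uniq

  Follows : (Fin n → Maybe (Fin m)) → Walk τ F a b → Set
  Follows g (here _)             = Unit
  Follows g (step {u} (e , _) p) = g u ≡ just e × Follows g p

  unique⇒follows : (g : Fin n → Maybe (Fin m)) (p : Walk τ F a b) → Unique (verts τ p) →
                   (∀ {u} → u ∈ʷ p → g u ≡ exitEdge p u) → Follows g p
  unique⇒follows g (here _)   _ _ = tt
  unique⇒follows g (step x p) (u∉p ∷ p-uniq) g≡exit =
    trans (g≡exit (here refl)) (exitEdge-source x p) ,
    unique⇒follows g p p-uniq λ u′∈p →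
      trans (g≡exit (there u′∈p)) (exitEdge-later x p (All.lookup u∉p u′∈p))

  follows⇒imageWalk : (g : Fin n → Maybe (Fin m)) (p : Walk τ F a b) → Follows g p →
                      Σ (Walk τ (image g) a b) λ q → verts τ q ≡ verts τ p
  follows⇒imageWalk g (here v) _ = here v , refl
  follows⇒imageWalk g (step {u} (e , _ , e-joins) p) (g≡e , p-follows)
    with q , q≡p ← follows⇒imageWalk g p p-follows =
    step (e , ∈-image g u g≡e , e-joins) q , cong (u ∷_) q≡p

  joins-sym : ∀ {e x y} → Joins e x y → Joins e y x
  joins-sym (inj₁ eq) = inj₂ eq
  joins-sym (inj₂ eq) = inj₁ eq

module Linkages (τ : Shape) where
  open Shape τ
  open Walks τ

  private variable
    F : EdgeSet τ
    A B S T : Subset n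
    x y : Fin n

  record Linkage (F : EdgeSet τ) (A B : Subset n) (k : ℕ) : Set where
    field
      source target : Fin k → Fin n
      source∈       : ∀ i → source i ∈ A
      target∈       : ∀ i → target i ∈ B
      walk          : ∀ i → Walk τ F (source i) (target i)
      disjoint      : ∀ {i j v} → v ∈ʷ walk i → v ∈ʷ walk j → i ≡ j

    target-injective : Injective _≡_ _≡_ target
    target-injective {i} {j} eq = disjoint (target∈ʷ (walk i)) (subst (_∈ʷ walk j) (sym eq) (target∈ʷ (walk j)))

  linkage⇒≤∣separator∣ : Linkage F A B k → Separates F A B T → k ≤ ∣ T ∣
  linkage⇒≤∣separator∣ {T = T} L sep =
    injective⇒≤∣p∣ T (λ i → proj₁ (meet i)) (λ i → proj₂ (proj₂ (meet i)))
      λ {i} {j} eq → disjoint (proj₁ (proj₂ (meet i))) (subst (_∈ʷ walk j) (sym eq) (proj₁ (proj₂ (meet j))))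
    where
    open Linkage L
    meet : ∀ i → ∃ λ v → v ∈ʷ walk i × v ∈ T
    meet i with Any.any? (_∈? T) (verts τ (walk i))
    ... | yes meets = find meets
    ... | no misses = ⊥-elim (sep (target∈ i) (reaching (source∈ i) (walk i) λ v∈ v∈T → misses (lose v∈ v∈T)))

  weakenLinkage : ∀ {F′} → F ⊆ F′ → Linkage F A B k → Linkage F′ A B k
  weakenLinkage F⊆F′ L = record
    { source = source ; target = target ; source∈ = source∈ ; target∈ = target∈
    ; walk     = λ i → weaken F⊆F′ (walk i)
    ; disjoint = λ v∈ v∈′ → disjoint (∈-weaken⁻ F⊆F′ (walk _) v∈) (∈-weaken⁻ F⊆F′ (walk _) v∈′)
    }
    where open Linkage L

  truncate : Linkage F A B k → Σ (Linkage F A B k) λ L → ∀ i → AvoidsInit B (Linkage.walk L i)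
  truncate {B = B} L = record
    { source = source ; target = λ i → hit (cut i) ; source∈ = source∈ ; target∈ = λ i → hit∈ (cut i)
    ; walk     = λ i → prefix (cut i)
    ; disjoint = λ v∈ v∈′ → disjoint (prefix⊆ (cut _) v∈) (prefix⊆ (cut _) v∈′)
    } , λ i → avoidsInit (cut i)
    where
    open Linkage L
    open FirstHit
    cut : ∀ i → FirstHit B (walk i)
    cut i = firstHitOfTarget (walk i) (target∈ i)

  edgeless⇒A∩B-separates : (∀ {e} → e ∉ F) → Separates F A B (A ∩ B)
  edgeless⇒A∩B-separates no-edges b∈B (reaching a∈A (here _) avoids) = avoids (here refl) (x∈p∩q⁺ (a∈A , b∈B))
  edgeless⇒A∩B-separates no-edges b∈B (reaching a∈A (step (e , e∈F , _) _) _) = no-edges e∈F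

  edgelessLinkage : (∀ {e} → e ∉ F) → (∀ T → Separates F A B T → k ≤ ∣ T ∣) → Linkage F A B k
  edgelessLinkage {A = A} {B = B} no-edges min-sep
    with f , f∈ , f-inj ← ≤∣p∣⇒injective (A ∩ B) (min-sep (A ∩ B) (edgeless⇒A∩B-separates no-edges)) = record
    { source = f ; target = f
    ; source∈ = λ i → proj₁ (x∈p∩q⁻ A B (f∈ i)) ; target∈ = λ i → proj₂ (x∈p∩q⁻ A B (f∈ i))
    ; walk     = λ i → here (f i)
    ; disjoint = λ { (here refl) (here eq) → f-inj eq }
    }

  endpoints : Fin m → Subset n
  endpoints e = ⁅ proj₁ (ends e) ⁆ ∪ ⁅ proj₂ (ends e) ⁆

  endsIn-endpoints : ∀ e → EndsIn e (endpoints e)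
  endsIn-endpoints e = x∈p∪q⁺ (inj₁ (x∈⁅x⁆ _)) , x∈p∪q⁺ (inj₂ (x∈⁅x⁆ _))

  endpoints⇒joins : ∀ {e} → x ∈ endpoints e → y ∈ endpoints e → x ≢ y → Joins e x y
  endpoints⇒joins x∈e y∈e x≢y with x∈p∪q⁻ _ _ x∈e | x∈p∪q⁻ _ _ y∈e
  ... | inj₁ x∈₁ | inj₁ y∈₁ = ⊥-elim (x≢y (trans (x∈⁅y⁆⇒x≡y _ x∈₁) (sym (x∈⁅y⁆⇒x≡y _ y∈₁))))
  ... | inj₂ x∈₂ | inj₂ y∈₂ = ⊥-elim (x≢y (trans (x∈⁅y⁆⇒x≡y _ x∈₂) (sym (x∈⁅y⁆⇒x≡y _ y∈₂))))
  ... | inj₁ x∈₁ | inj₂ y∈₂ = inj₁ (cong₂ _,_ (sym (x∈⁅y⁆⇒x≡y _ x∈₁)) (sym (x∈⁅y⁆⇒x≡y _ y∈₂)))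
  ... | inj₂ x∈₂ | inj₁ y∈₁ = inj₂ (cong₂ _,_ (sym (x∈⁅y⁆⇒x≡y _ y∈₁)) (sym (x∈⁅y⁆⇒x≡y _ x∈₂)))

  crossingEndpoint : ∀ {e b} → Separates (F - e) A B S → b ∈ B → Reaching F S A b →
                     ∃ λ z → z ∈ endpoints e × Reaching (F - e) S A z
  crossingEndpoint {e = e} sep b∈B (reaching a∈A p p-avoids) with firstHit? (endpoints e) p
  ... | inj₁ p-avoids-e =
    let q , q≡p = withoutEdge p (avoids⇒avoidsInit p p-avoids-e) (endsIn-endpoints e) in
    ⊥-elim (sep b∈B (reaching a∈A q (avoids-≡ q≡p p-avoids)))
  ... | inj₂ (firstHit z∈e P P-init P⊆p) =
    let q , q≡P = withoutEdge P P-init (endsIn-endpoints e) in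
    _ , z∈e , reaching a∈A q (avoids-≡ q≡P λ v∈P → p-avoids (P⊆p v∈P))

  crossingEdge : ∀ {e b} → Separates (F - e) A B S → b ∈ B → Reaching F S A b →
                 ∃₂ λ x y → Joins e x y × Reaching (F - e) S A x × Reaching (F - e) S B y
  crossingEdge sep b∈B r@(reaching a∈A p p-avoids)
    with x , x∈e , A-reaches-x ← crossingEndpoint sep b∈B r
    with y , y∈e , B-reaches-y ← crossingEndpoint (separates-sym sep) a∈A
                                   (reaching b∈B (reverseʷ p) (avoids-reverseʷ p p-avoids))
    with x ≟ y
  ... | yes refl = ⊥-elim (meeting⇒¬separates A-reaches-x B-reaches-y sep)
  ... | no x≢y   = x , y , endpoints⇒joins x∈e y∈e x≢y , A-reaches-x , B-reaches-y

  -- An A–B walk avoiding T must reach S + x + y, for otherwise it avoids both e and S; if it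
  -- reaches y first, it continues to B along the reversed B–y walk, avoiding S.
  separates-S+x⇒separates : ∀ {e} → Joins e x y → Separates (F - e) A B S → Reaching (F - e) S B y →
                            Separates (F - e) A (S ∪ ⁅ x ⁆) T → Separates F A B T
  separates-S+x⇒separates {x = x} {y = y} {S = S} {e = e}
                          e-joins S-sep B-reaches-y X-sep b∈B (reaching a∈A p p-avoids-T) =
    byFirstHit (firstHit? Z p)
    where
    Z : Subset n
    Z = (S ∪ ⁅ x ⁆) ∪ ⁅ y ⁆
    S⊆Z : S ⊆ Z
    S⊆Z v∈S = x∈p∪q⁺ (inj₁ (x∈p∪q⁺ (inj₁ v∈S)))
    e-in-Z : EndsIn e Z
    e-in-Z = joins⇒endsIn e-joins (x∈p∪q⁺ (inj₁ (x∈p∪q⁺ (inj₂ (x∈⁅x⁆ x))))) (x∈p∪q⁺ (inj₂ (x∈⁅x⁆ y)))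
    y∉S : y ∉ S
    y∉S = Reaching.avoids B-reaches-y (target∈ʷ (Reaching.walk B-reaches-y))

    byFirstHit : Avoids Z p ⊎ FirstHit Z p → Empty
    byFirstHit (inj₁ p-avoids-Z) =
      let q , q≡p = withoutEdge p (avoids⇒avoidsInit p p-avoids-Z) e-in-Z in
      S-sep b∈B (reaching a∈A q (avoids-≡ q≡p λ v∈p v∈S → p-avoids-Z v∈p (S⊆Z v∈S)))
    byFirstHit (inj₂ (firstHit z∈Z P P-init P⊆p))
      with q , q≡P ← withoutEdge P P-init e-in-Z
      with x∈p∪q⁻ (S ∪ ⁅ x ⁆) ⁅ y ⁆ z∈Z
    ... | inj₁ z∈S+x = X-sep z∈S+x (reaching a∈A q (avoids-≡ q≡P λ v∈P → p-avoids-T (P⊆p v∈P)))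
    ... | inj₂ z∈⁅y⁆ with refl ← x∈⁅y⁆⇒x≡y y z∈⁅y⁆ =
      meeting⇒¬separates (reaching a∈A q (avoids-≡ q≡P (avoidsInit⇒avoids P P-init S⊆Z y∉S))) B-reaches-y S-sep

  -- By
  -- separates-S+x⇒separates and induction, F − e has k disjoint walks from A to X = S + x and k
  -- from B to Y = S + y, cut at their first vertex of X resp. Y. As |Y| ≤ k, the B-walks end at
  -- all of Y, so an A-walk ending at z ∈ S continues along the B-walk ending at z, and one ending
  -- at x along e and the B-walk ending at y. An A-walk and a B-walk can only meet at a common end
  -- in S, so the glued walks are disjoint.
  module Exchange {k} {F : EdgeSet τ} {e : Fin m} (e∈F : e ∈ F) {A B S : Subset n} {x y : Fin n}
                  (e-joins : Joins e x y) (S-sep : Separates (F - e) A B S) (∣S∣<k : ∣ S ∣ < k)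
                  (min-sep : ∀ T → Separates F A B T → k ≤ ∣ T ∣)
                  (A-reaches-x : Reaching (F - e) S A x) (B-reaches-y : Reaching (F - e) S B y)
                  (menger-F-e : ∀ {A′ B′} → (∀ T → Separates (F - e) A′ B′ T → k ≤ ∣ T ∣) →
                                Linkage (F - e) A′ B′ k)
                  where
    X Y : Subset n
    X = S ∪ ⁅ x ⁆
    Y = S ∪ ⁅ y ⁆

    S⊆X : S ⊆ X
    S⊆X v∈S = x∈p∪q⁺ (inj₁ v∈S)
    S⊆Y : S ⊆ Y
    S⊆Y v∈S = x∈p∪q⁺ (inj₁ v∈S)

    x∉S : x ∉ S
    x∉S = Reaching.avoids A-reaches-x (target∈ʷ (Reaching.walk A-reaches-x))
    y∉S : y ∉ S
    y∉S = Reaching.avoids B-reaches-y (target∈ʷ (Reaching.walk B-reaches-y))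

    A-to-X : Σ (Linkage (F - e) A X k) λ L → ∀ i → AvoidsInit X (Linkage.walk L i)
    A-to-X = truncate (menger-F-e λ T T-sep →
      min-sep T (separates-S+x⇒separates e-joins S-sep B-reaches-y T-sep))
    B-to-Y : Σ (Linkage (F - e) B Y k) λ L → ∀ i → AvoidsInit Y (Linkage.walk L i)
    B-to-Y = truncate (menger-F-e λ T T-sep →
      min-sep T (separates-sym (separates-S+x⇒separates (joins-sym e-joins) (separates-sym S-sep) A-reaches-x T-sep)))

    module L₁ = Linkage (proj₁ A-to-X)
    module L₂ = Linkage (proj₁ B-to-Y)

    bridgeEnd : ∀ {z} → z ∈ S ⊎ z ≡ x → Fin n
    bridgeEnd {z} (inj₁ _) = z
    bridgeEnd     (inj₂ _) = y

    bridge : ∀ {z} (side : z ∈ S ⊎ z ≡ x) → Walk τ F z (bridgeEnd side)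
    bridge {z} (inj₁ _)    = here z
    bridge     (inj₂ refl) = step (e , e∈F , e-joins) (here y)

    ∈-bridge : ∀ {z v} (side : z ∈ S ⊎ z ≡ x) → v ∈ʷ bridge side → v ≡ z ⊎ v ≡ bridgeEnd side
    ∈-bridge (inj₁ _)    (here refl)         = inj₁ refl
    ∈-bridge (inj₂ refl) (here refl)         = inj₁ refl
    ∈-bridge (inj₂ refl) (there (here refl)) = inj₂ refl

    bridgeEnd∈Y : ∀ {z} (side : z ∈ S ⊎ z ≡ x) → bridgeEnd side ∈ Y
    bridgeEnd∈Y (inj₁ z∈S) = S⊆Y z∈S
    bridgeEnd∈Y (inj₂ _)   = x∈p∪q⁺ (inj₂ (x∈⁅x⁆ y))

    bridgeEnd-∈S : ∀ {z} (side : z ∈ S ⊎ z ≡ x) → z ∈ S → bridgeEnd side ≡ z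
    bridgeEnd-∈S (inj₁ _)    _   = refl
    bridgeEnd-∈S (inj₂ refl) x∈S = ⊥-elim (x∉S x∈S)

    bridgeEnd-injective : ∀ {z z′} (side : z ∈ S ⊎ z ≡ x) (side′ : z′ ∈ S ⊎ z′ ≡ x) →
                          bridgeEnd side ≡ bridgeEnd side′ → z ≡ z′
    bridgeEnd-injective (inj₁ _)    (inj₁ _)    eq   = eq
    bridgeEnd-injective (inj₁ z∈S)  (inj₂ _)    refl = ⊥-elim (y∉S z∈S)
    bridgeEnd-injective (inj₂ _)    (inj₁ z′∈S) refl = ⊥-elim (y∉S z′∈S)
    bridgeEnd-injective (inj₂ refl) (inj₂ refl) _    = refl

    side : ∀ i → L₁.target i ∈ S ⊎ L₁.target i ≡ x
    side i = map₂ (x∈⁅y⁆⇒x≡y x) (x∈p∪q⁻ S ⁅ x ⁆ (L₁.target∈ i))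

    partner : ∀ i → ∃ λ j → L₂.target j ≡ bridgeEnd (side i)
    partner i = injective⇒surjective Y L₂.target L₂.target∈ L₂.target-injective
                  (≤-trans (∣p∪⁅x⁆∣≤1+∣p∣ S y) ∣S∣<k) (bridgeEnd∈Y (side i))

    σ : Fin k → Fin k
    σ i = proj₁ (partner i)

    F-e⊆F : F - e ⊆ F
    F-e⊆F = p─q⊆p F ⁅ e ⁆

    joined : ∀ i → Walk τ F (L₁.source i) (L₂.source (σ i))
    joined i = weaken F-e⊆F (L₁.walk i) ++ʷ
               bridge (side i) ++ʷ⟨ sym (proj₂ (partner i)) ⟩ weaken F-e⊆F (reverseʷ (L₂.walk (σ i)))

    ∈-sandwich⁻ : ∀ {a z c d v} (P : Walk τ (F - e) a z) (side : z ∈ S ⊎ z ≡ x) (end≡c : bridgeEnd side ≡ c)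
                  (R : Walk τ (F - e) d c) →
                  v ∈ʷ weaken F-e⊆F P ++ʷ bridge side ++ʷ⟨ end≡c ⟩ weaken F-e⊆F (reverseʷ R) → v ∈ʷ P ⊎ v ∈ʷ R
    ∈-sandwich⁻ P side refl R v∈ with ∈-++ʷ⁻ (weaken F-e⊆F P) v∈
    ... | inj₁ v∈P = inj₁ (∈-weaken⁻ F-e⊆F P v∈P)
    ... | inj₂ v∈rest with ∈-++ʷ⁻ (bridge side) v∈rest
    ...   | inj₂ v∈R = inj₂ (∈-reverseʷ⁻ R (∈-weaken⁻ F-e⊆F (reverseʷ R) v∈R))
    ...   | inj₁ v∈bridge with ∈-bridge side v∈bridge
    ...     | inj₁ refl = inj₁ (target∈ʷ P)
    ...     | inj₂ refl = inj₂ (target∈ʷ R)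

    ∈-joined⁻ : ∀ {i v} → v ∈ʷ joined i → v ∈ʷ L₁.walk i ⊎ v ∈ʷ L₂.walk (σ i)
    ∈-joined⁻ {i} = ∈-sandwich⁻ (L₁.walk i) (side i) (sym (proj₂ (partner i))) (L₂.walk (σ i))

    meet∈S : ∀ {i j v} → v ∈ʷ L₁.walk i → v ∈ʷ L₂.walk j → v ∈ S
    meet∈S {i} {j} {v} v∈P v∈R with v ∈? S
    ... | yes v∈S = v∈S
    ... | no  v∉S =
      let P′ , P′-avoids = prefixAvoiding (L₁.walk i) (proj₂ A-to-X i) S⊆X v∈P v∉S
          R′ , R′-avoids = prefixAvoiding (L₂.walk j) (proj₂ B-to-Y j) S⊆Y v∈R v∉S
      in ⊥-elim (meeting⇒¬separates (reaching (L₁.source∈ i) P′ P′-avoids)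
                                    (reaching (L₂.source∈ j) R′ R′-avoids) S-sep)

    meet⇒partner : ∀ {i j v} → v ∈ʷ L₁.walk i → v ∈ʷ L₂.walk j → σ i ≡ j
    meet⇒partner {i} {j} v∈P v∈R = L₂.target-injective (begin
      L₂.target (σ i)          ≡⟨ proj₂ (partner i) ⟩
      bridgeEnd (side i)       ≡⟨ bridgeEnd-∈S (side i) (subst (_∈ S) v≡z v∈S) ⟩
      L₁.target i              ≡⟨ sym v≡z ⟩
      _                        ≡⟨ avoidsInit-target (L₂.walk j) (proj₂ B-to-Y j) v∈R (S⊆Y v∈S) ⟩
      L₂.target j              ∎)
      where
      open ≡-Reasoning
      v∈S = meet∈S v∈P v∈R
      v≡z = avoidsInit-target (L₁.walk i) (proj₂ A-to-X i) v∈P (S⊆X v∈S)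

    σ-injective : Injective _≡_ _≡_ σ
    σ-injective {i} {i′} σi≡σi′ = L₁.target-injective (bridgeEnd-injective (side i) (side i′)
      (trans (sym (proj₂ (partner i))) (trans (cong L₂.target σi≡σi′) (proj₂ (partner i′)))))

    paired-disjoint : ∀ {i i′ v} → v ∈ʷ L₁.walk i ⊎ v ∈ʷ L₂.walk (σ i) →
                      v ∈ʷ L₁.walk i′ ⊎ v ∈ʷ L₂.walk (σ i′) → i ≡ i′
    paired-disjoint (inj₁ v∈P) (inj₁ v∈P′) = L₁.disjoint v∈P v∈P′
    paired-disjoint (inj₂ v∈R) (inj₂ v∈R′) = σ-injective (L₂.disjoint v∈R v∈R′)
    paired-disjoint (inj₁ v∈P) (inj₂ v∈R′) = σ-injective (meet⇒partner v∈P v∈R′)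
    paired-disjoint (inj₂ v∈R) (inj₁ v∈P′) = σ-injective (sym (meet⇒partner v∈P′ v∈R))

    linkage : Linkage F A B k
    linkage = record
      { source = L₁.source ; target = λ i → L₂.source (σ i)
      ; source∈ = L₁.source∈ ; target∈ = λ i → L₂.source∈ (σ i)
      ; walk = joined ; disjoint = λ v∈ v∈′ → paired-disjoint (∈-joined⁻ v∈) (∈-joined⁻ v∈′)
      }

  menger-step : ∀ {e} → e ∈ F →
                (∀ {A′ B′} → (∀ T → Separates (F - e) A′ B′ T → k ≤ ∣ T ∣) → Linkage (F - e) A′ B′ k) →
                (∀ T → Separates F A B T → k ≤ ∣ T ∣) → Linkage F A B k
  menger-step {F = F} {k = k} {A = A} {B = B} {e = e} e∈F menger-F-e min-sep
    with anySubset? (λ S → separates? (F - e) A B S ×-dec (∣ S ∣ <? k))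
  ... | no no-small-separator =
    weakenLinkage (p─q⊆p F ⁅ e ⁆)
      (menger-F-e λ T T-sep → ≮⇒≥ λ ∣T∣<k → no-small-separator (T , T-sep , ∣T∣<k))
  ... | yes (S , S-sep , ∣S∣<k) with reaches? F S A B
  ...   | no unreachable = ⊥-elim (<⇒≱ ∣S∣<k (min-sep S λ b∈B r → unreachable (_ , b∈B , r)))
  ...   | yes (_ , b∈B , r) with _ , _ , e-joins , A-reaches-x , B-reaches-y ← crossingEdge S-sep b∈B r =
    Exchange.linkage e∈F e-joins S-sep ∣S∣<k min-sep A-reaches-x B-reaches-y menger-F-e

  mengerBelow : ∀ c F → ∣ F ∣ < c → ∀ {A B} → (∀ T → Separates F A B T → k ≤ ∣ T ∣) → Linkage F A B k
  mengerBelow (suc c) F ∣F∣<1+c with nonempty? F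
  ... | no  F≡∅       = edgelessLinkage (λ e∈F → F≡∅ (_ , e∈F))
  ... | yes (e , e∈F) =
    menger-step e∈F (mengerBelow c (F - e) (<-≤-trans (x∈p⇒∣p-x∣<∣p∣ e∈F) (≤-pred ∣F∣<1+c)))

  menger : ∀ F {A B} → (∀ T → Separates F A B T → k ≤ ∣ T ∣) → Linkage F A B k
  menger F = mengerBelow (suc ∣ F ∣) F ≤-refl

module Residual (τ : Shape) (middle : IsMiddle τ) (connected : Connected τ (AllEdges τ)) where
  open Shape τ
  open Walks τ
  open Linkages τ

  U-minimum : ∀ T → Separates (AllEdges τ) U V T → ∣ U ∣ ≤ ∣ T ∣
  U-minimum T T-sep = proj₂ (proj₁ (proj₁ middle)) T (separates⇒isSeparator T-sep)

  U-separates : ∀ F → IsSeparator τ F U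
  U-separates F a b a∈U b∈V (p , _) = lose (source∈ʷ p) a∈U

  truncated : Σ (Linkage (AllEdges τ) U V ∣ U ∣) λ L → ∀ i → AvoidsInit V (Linkage.walk L i)
  truncated = truncate (menger (AllEdges τ) U-minimum)

  module L = Linkage (proj₁ truncated)

  path : ∀ i → Walk τ (AllEdges τ) (L.source i) (L.target i)
  path i = proj₁ (loopErase (L.walk i))

  path-unique : ∀ i → Unique (verts τ (path i))
  path-unique i = proj₁ (proj₂ (loopErase (L.walk i)))

  path-disjoint : ∀ {i j v} → v ∈ʷ path i → v ∈ʷ path j → i ≡ j
  path-disjoint {i} {j} v∈i v∈j =
    L.disjoint (proj₂ (proj₂ (loopErase (L.walk i))) v∈i) (proj₂ (proj₂ (loopErase (L.walk j))) v∈j)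

  path-V : ∀ {i v} → v ∈ʷ path i → v ∈ V → v ≡ L.target i
  path-V {i} v∈ = avoidsInit-target (L.walk i) (proj₂ truncated i) (proj₂ (proj₂ (loopErase (L.walk i))) v∈)

  Near : ℕ → Fin n → Set
  Near = ReachesWithin (AllEdges τ) ⊥ (U ∪ V)

  nearest : ∀ v → ∃ λ d → Near d v × (∀ {j} → j < d → ¬ Near j v)
  nearest v with _ , b∈UV , p , _ ← connected v =
    least-witness (λ l → reachesWithin? (AllEdges τ) ⊥ (U ∪ V) l v)
                  (walk⇒reachesWithin p b∈UV (λ _ → ∉⊥) ≤-refl)

  depth : Fin n → ℕ
  depth v = proj₁ (nearest v)

  depth-minimal : ∀ {l w} → Near l w → depth w ≤ l
  depth-minimal {w = w} near = ≮⇒≥ λ l<depth → proj₂ (proj₂ (nearest w)) l<depth near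

  firstStep : ∀ {l v} → Near l v → Maybe (Fin m)
  firstStep {zero}  _                            = nothing
  firstStep {suc l} (inj₁ _)                     = nothing
  firstStep {suc l} (inj₂ (_ , _ , (e , _) , _)) = just e

  firstStep-joins : ∀ {d v} (near : Near d v) → (∀ {j} → j < d → ¬ Near j v) → v ∉ U ∪ V →
                    ∃₂ λ e w → firstStep near ≡ just e × Joins e v w × depth w < d
  firstStep-joins {zero}  (_ , v∈UV) _ v∉UV = ⊥-elim (v∉UV v∈UV)
  firstStep-joins {suc d} (inj₁ near₀) closer _ = ⊥-elim (closer (s≤s z≤n) near₀)
  firstStep-joins {suc d} (inj₂ (_ , w , (e , _ , e-joins) , near-w)) _ _ =
    e , w , refl , e-joins , s≤s (depth-minimal near-w)

  towardsUV : Fin n → Maybe (Fin m)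
  towardsUV v = firstStep (proj₁ (proj₂ (nearest v)))

  onPath? : ∀ v → Dec (∃ λ i → v ∈ʷ path i)
  onPath? v = any? λ i → Any.any? (v ≟_) (verts τ (path i))

  parent : Fin n → Maybe (Fin m)
  parent v with onPath? v | v ∈? U ∪ V
  ... | yes (i , _) | _     = exitEdge (path i) v
  ... | no _        | yes _ = nothing
  ... | no _        | no _  = towardsUV v

  parent-onPath : ∀ {i v} → v ∈ʷ path i → parent v ≡ exitEdge (path i) v
  parent-onPath {i} {v} v∈ with onPath? v | v ∈? U ∪ V
  ... | yes (_ , v∈′) | _ rewrite path-disjoint v∈′ v∈ = refl
  ... | no off        | _ = ⊥-elim (off (i , v∈))

  parent-offPath : ∀ {v} → v ∉ U ∪ V → ¬ (∃ λ i → v ∈ʷ path i) → parent v ≡ towardsUV v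
  parent-offPath {v} v∉UV off with onPath? v | v ∈? U ∪ V
  ... | yes on | _       = ⊥-elim (off on)
  ... | no _   | yes v∈UV = ⊥-elim (v∉UV v∈UV)
  ... | no _   | no _     = refl

  parent-U∩V : ∀ {v} → v ∈ U ∩ V → parent v ≡ nothing
  parent-U∩V {v} v∈U∩V with onPath? v | v ∈? U ∪ V
  ... | yes (i , v∈) | _ =
    trans (cong (exitEdge (path i)) (path-V v∈ (proj₂ (x∈p∩q⁻ U V v∈U∩V))))
          (exitEdge-target (path i) (path-unique i))
  ... | no _ | yes _    = refl
  ... | no _ | no v∉UV  = ⊥-elim (v∉UV (x∈p∪q⁺ (inj₁ (proj₁ (x∈p∩q⁻ U V v∈U∩V)))))

  Res : EdgeSet τ
  Res = image parent

  ∣Res∣≤nonShared : ∣ Res ∣ ≤ nonShared τ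
  ∣Res∣≤nonShared = ∣image∣≤∣p∣ parent (∁ (U ∩ V)) λ v v∉ → parent-U∩V (x∉∁p⇒x∈p v∉)

  pathInRes : ∀ i → Σ (Walk τ Res (L.source i) (L.target i)) λ q → verts τ q ≡ verts τ (path i)
  pathInRes i = follows⇒imageWalk parent (path i) (unique⇒follows parent (path i) (path-unique i) parent-onPath)

  linkageInRes : Linkage Res U V ∣ U ∣
  linkageInRes = record
    { source = L.source ; target = L.target ; source∈ = L.source∈ ; target∈ = L.target∈
    ; walk     = λ i → proj₁ (pathInRes i)
    ; disjoint = λ {i} {j} v∈i v∈j →
        path-disjoint (subst (_ ∈ₗ_) (proj₂ (pathInRes i)) v∈i) (subst (_ ∈ₗ_) (proj₂ (pathInRes j)) v∈j)
    }

  mvs-size : ∀ F → Res ⊆ F → ∀ S → IsMVS τ F S → ∣ S ∣ ≡ ∣ U ∣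
  mvs-size F Res⊆F S (S-sep , S-min) =
    ≤-antisym (S-min U (U-separates F))
              (linkage⇒≤∣separator∣ (weakenLinkage Res⊆F linkageInRes) (isSeparator⇒separates S-sep))

  reachesUV : ∀ c v → depth v < c → ∃ λ b → b ∈ U ∪ V × Walk τ Res v b
  reachesUV (suc c) v (s≤s depth≤c) with v ∈? U ∪ V | onPath? v
  ... | yes v∈UV | _ = v , v∈UV , here v
  ... | no _ | yes (i , v∈path) =
    let q , q≡path = pathInRes i in
    L.target i , x∈p∪q⁺ (inj₂ (L.target∈ i)) , proj₁ (suffixFrom q (subst (_ ∈ₗ_) (sym q≡path) v∈path))
  ... | no v∉UV | no off
    with e , w , towards≡e , e-joins , depth-w<depth-v ←
         firstStep-joins (proj₁ (proj₂ (nearest v))) (proj₂ (proj₂ (nearest v))) v∉UV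
    with b , b∈UV , p ← reachesUV c w (<-≤-trans depth-w<depth-v depth≤c) =
    b , b∈UV , step (e , ∈-image parent v (trans (parent-offPath v∉UV off) towards≡e) , e-joins) p

  Res-connected : Connected τ Res
  Res-connected v with b , b∈UV , p ← reachesUV (suc (depth v)) v ≤-refl = b , b∈UV , toPath p

mainTheorem10 : (τ : Shape) → IsMiddle τ → Connected τ (AllEdges τ) →
    Σ (EdgeSet τ) λ Res →
      (∣ Res ∣ ≤ nonShared τ) ×
      Connected τ Res ×
      (∀ F → Res ⊆ F → ∀ S S' → IsMVS τ (AllEdges τ) S → IsMVS τ F S' → ∣ S ∣ ≡ ∣ S' ∣)
mainTheorem10 τ middle connected =
  Res , ∣Res∣≤nonShared , Res-connected ,
  λ F Res⊆F S S′ S-mvs S′-mvs →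
    trans (mvs-size (AllEdges τ) (λ _ → ∈⊤) S S-mvs) (sym (mvs-size F Res⊆F S′ S′-mvs))
  where open Residual τ middle connected
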